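{- For every $d\ge 1$ there is a bounded Streett game with costs $\mathcal{G}_d$ with a designated vertex $v$ such that: the arena of $\mathcal{G}_d$ has size linear in $d$ and $\mathcal{G}_d$ has $2d$ Streett pairs; Player $1$ has a finite-state winning strategy for $\mathcal{G}_d$ from $v$ that is implemented with $2^d$ memory states; but Player $1$ has no winning strategy from $v$ that is implemented with fewer than $2^d$ memory states.
   Context: An arena is a tuple $\mathcal{A}=(V,V_0,V_1,E)$ where $(V,E)$ is a finite directed graph in which every vertex has at least one outgoing edge, and $\{V_0,V_1\}$ is a partition of $V$. A play is an infinite path $\rho=\rho_0\rho_1\cdots$ in $(V,E)$. A game $(\mathcal{A},\mathrm{Win})$ has Player $0$ winning the plays in $\mathrm{Win}\subseteq V^\omega$ and Player $1$ the others. A strategy for Player $i$ is a map $\sigma:V^*V_i\to V$ with $(v,\sigma(wv))\in E$; it is winning from $W$ if all plays starting in $W$ consistent with it are won by Player $i$. A memory structure is $\mathcal{M}=(M,\mathrm{Init},\mathrm{Upd})$ with $M$ finite, $\mathrm{Init}:V\to M$, $\mathrm{Upd}:M\times V\to M$, extended by $\mathrm{Upd}^+(\rho_0)=\mathrm{Init}(\rho_0)$, $\mathrm{Upd}^+(wv)=\mathrm{Upd}(\mathrm{Upd}^+(w),v)$; with a next-move function $\mathrm{Nxt}:V_i\times M\to V$ it implements $\sigma(\rho_0\cdots\rho_n)=\mathrm{Nxt}(\rho_n,\mathrm{Upd}^+(\rho_0\cdots\rho_n))$, a finite-state strategy with $|M|$ memory states. A cost function is $\mathrm{Cst}:E\to\{\epsilon,i\}$;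 edges labelled $i$ are increment-edges; the cost of a path is the number of increment-edges it traverses. For $k\ge1$ let $[k]=\{0,\dots,k-1\}$, $\Gamma=(Q_c,P_c)_{c\in[k]}$ with $Q_c,P_c\subseteq V$ (Streett pairs), and $\overline{\mathrm{Cst}}=(\mathrm{Cst}_c)_{c\in[k]}$ cost functions. For a play $\rho$ and position $n$ set $\mathrm{StCor}_c(\rho,n)=0$ if $\rho_n\notin Q_c$ and $\mathrm{StCor}_c(\rho,n)=\min\{\mathrm{Cst}_c(\rho_n\cdots\rho_{n'}):n'\ge n,\ \rho_{n'}\in P_c\}$ ($\min\emptyset=\infty$) otherwise; $\mathrm{StCor}(\rho,n)=\max_c\mathrm{StCor}_c(\rho,n)$. The requests at $n$ are unanswered with cost $\infty$ if $\mathrm{StCor}(\rho,n)=\infty$ and, for some $c$ with $\rho_n\in Q_c$, infinitely many increment-edges w.r.t. $\mathrm{Cst}_c$ are traversed after $n$. A bounded Streett game with costs is $(\mathcal{A},\mathrm{BndCostStreett}(\Gamma,\overline{\mathrm{Cst}}))$ where $\mathrm{BndCostStreett}(\Gamma,\overline{\mathrm{Cst}})$ is the set of plays with $\limsup_{n\to\infty}\mathrm{StCor}(\rho,n)<\infty$ in which no requests are unanswered with cost $\infty$; $k$ is its number of Streett pairs. -}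

module Defs where

open import Data.Nat using (ℕ; zero; suc; _+_; _≤_)
open import Data.Fin using (Fin)
open import Data.Bool using (Bool; true; false)
open import Data.List using (List; []; _∷_; map; upTo)
open import Data.Product using (Σ; Σ-syntax; ∃-syntax; _×_; proj₁)
open import Data.Sum using (_⊎_)
open import Relation.Binary.PropositionalEquality using (_≡_)
open import Relation.Nullary using (¬_)

data Player : Set where
  P0 P1 : Player

-- Streett pairs (Q c, P c) for c ∈ [k]; cost functions Cst c : E → {ε, i}
-- with 'true' meaning increment-edge (values on non-edges are irrelevant).
record Game : Set where
  field
    nV     : ℕ
    owner  : Fin nV → Player
    edge   : Fin nV → Fin nV → Bool
    total  : (v : Fin nV) → ∃[ w ] (edge v w ≡ true)
    k      : ℕ
    Q      : Fin k → Fin nV → Bool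
    P      : Fin k → Fin nV → Bool
    Cst    : Fin k → Fin nV → Fin nV → Bool

module _ (G : Game) where
  open Game G

  V : Set
  V = Fin nV

  record Play : Set where
    field
      ρ     : ℕ → V
      isPath : (n : ℕ) → edge (ρ n) (ρ (suc n)) ≡ true
  open Play public

  Strategy : Player → Set
  Strategy i = (w : List V) → (v : V) → owner v ≡ i → Σ[ u ∈ V ] (edge v u ≡ true)

  prefix : Play → ℕ → List V
  prefix π n = map (ρ π) (upTo n)

  Consistent : {i : Player} → Strategy i → Play → Set
  Consistent {i} σ π = (n : ℕ) (o : owner (ρ π n) ≡ i) →
    ρ π (suc n) ≡ proj₁ (σ (prefix π n) (ρ π n) o)

  cost : Fin k → Play → ℕ → ℕ → ℕ
  cost c π n zero = zero
  cost c π n (suc len) with Cst c (ρ π (n + len)) (ρ π (suc (n + len)))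
  ... | true  = suc (cost c π n len)
  ... | false = cost c π n len

  -- StCor_c(ρ,n) ≤ b   (unfolding the min over answering positions)
  StCorC≤ : Fin k → Play → ℕ → ℕ → Set
  StCorC≤ c π n b = (Q c (ρ π n) ≡ false)
    ⊎ (∃[ l ] (P c (ρ π (n + l)) ≡ true × cost c π n l ≤ b))

  StCor≤ : Play → ℕ → ℕ → Set
  StCor≤ π n b = (c : Fin k) → StCorC≤ c π n b

  StCorInf : Play → ℕ → Set
  StCorInf π n = ∃[ c ] (Q c (ρ π n) ≡ true × ((l : ℕ) → P c (ρ π (n + l)) ≡ false))

  InfInc : Fin k → Play → ℕ → Set
  InfInc c π n = (N : ℕ) → ∃[ j ] (N ≤ j × Cst c (ρ π (n + j)) (ρ π (suc (n + j))) ≡ true)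

  UnansweredInf : Play → ℕ → Set
  UnansweredInf π n = StCorInf π n × ∃[ c ] (Q c (ρ π n) ≡ true × InfInc c π n)

  LimsupFinite : Play → Set
  LimsupFinite π = ∃[ b ] ∃[ N ] ((n : ℕ) → N ≤ n → StCor≤ π n b)

  BndCostStreett : Play → Set
  BndCostStreett π = LimsupFinite π × ((n : ℕ) → ¬ UnansweredInf π n)

  WonBy : Player → Play → Set
  WonBy P0 π = BndCostStreett π
  WonBy P1 π = ¬ BndCostStreett π

  WinningFrom : (i : Player) → Strategy i → V → Set
  WinningFrom i σ v = (π : Play) → ρ π 0 ≡ v → Consistent σ π → WonBy i π

  module _ {m : ℕ} (Init : V → Fin m) (Upd : Fin m → V → Fin m) where
    updFrom : Fin m → List V → Fin m
    updFrom s [] = s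
    updFrom s (y ∷ ys) = updFrom (Upd s y) ys

    upd⁺ : List V → V → Fin m
    upd⁺ [] v = Init v
    upd⁺ (x ∷ xs) v = Upd (updFrom (Init x) xs) v

  implemented : (i : Player) {m : ℕ} (Init : V → Fin m) (Upd : Fin m → V → Fin m)
    (Nxt : (v : V) → owner v ≡ i → Fin m → Σ[ u ∈ V ] (edge v u ≡ true)) → Strategy i
  implemented i Init Upd Nxt w v o = Nxt v o (upd⁺ Init Upd w v)

  WinsWithMemory : Player → V → ℕ → Set
  WinsWithMemory i v m =
    Σ[ Init ∈ (V → Fin m) ] Σ[ Upd ∈ (Fin m → V → Fin m) ]
    Σ[ Nxt ∈ ((u : V) → owner u ≡ i → Fin m → Σ[ u' ∈ V ] (edge u u' ≡ true)) ]
      WinningFrom i (implemented i Init Upd Nxt) v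

-- Player 0 first announces d bits (choose 0 x₀, …, choose (d - 1) xₙ), Player 1 then repeats
-- them (copy 0 y₀, …), and Player 0 finally tests an index k before the play falls into the sink,
-- whose loop is the only edge with cost. Pair (r, i) is requested at choose i r and answered at
-- copy i c with c ≠ r or at test k with k ≠ i, so the only request that can stay unanswered is
-- (xₖ, k), and it does exactly when yₖ = xₖ, at infinite cost. Remembering the announced bits in
-- 2^d memory states therefore wins for Player 1. With fewer states, two different announcements
-- reach the copy phase in the same memory state (pigeonhole). Player 1 alone moves during that
-- phase, so she copies the same bits after both, and testing an index where the announcements
-- differ defeats her in one of the two plays.
module Submission where

open import Defs
open import Axiom.UniquenessOfIdentityProofs.WithK using (uip)
open import Data.Bool using (Bool; true; false; _∧_; not)
open import Data.Bool.Properties using (T-≡; ¬-not)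
open import Data.Empty using (⊥; ⊥-elim)
open import Data.Fin using (Fin; zero; suc; toℕ; fromℕ; fromℕ<; inject₁; combine; remQuot; finToFun; funToFin; _≟_)
open import Data.Fin.Properties
  using (toℕ-injective; toℕ<n; toℕ-fromℕ; toℕ-fromℕ<; toℕ-inject₁; remQuot-combine;
         funToFin-finToFin; finToFun-funToFin; pigeonhole; ¬∀⟶∃¬)
  renaming (<⇒≢ to <ᶠ⇒≢)
open import Data.Fin.Relation.Unary.Top using (view; ‵fromℕ; ‵inject₁; view-fromℕ; view-inject₁)
open import Data.List using ([]; _∷_; map; upTo; _∷ʳ_)
open import Data.List.Properties using (upTo-∷ʳ; map-++)
open import Data.Nat using (ℕ; zero; suc; _+_; _∸_; _*_; _^_; _⊓_; _≡ᵇ_; _≤_; _<_; s≤s; s≤s⁻¹)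
open import Data.Nat.Properties
  using (+-suc; +-identityʳ; +-cancelˡ-≡; suc-injective; ≤-refl; ≤-trans; <-≤-trans; <⇒≤; <⇒≢;
         m<n⇒m<1+n; n≤1+n; m≤n⇒m≤1+n; m≤m+n; m≤n+m; m≤n⇒m≤o+n; +-monoʳ-≤;
         m≢1+m+n; m≢1+n+m; 1+n≢n; ≡ᵇ⇒≡; ≡⇒≡ᵇ;
         ⊓-assoc; ⊓-sel; ≤∧≢⇒<; <⇒≱; m+[n∸m]≡n; ⊓-idem; m≤n⇒m⊓n≡m; m≥n⇒m⊓n≡n)
  renaming (_≟_ to _≟ℕ_)
open import Data.Product using (Σ-syntax; _×_; _,_; proj₁; proj₂; uncurry)
open import Data.Sum using (_⊎_; inj₁; inj₂)
open import Data.Vec.Functional using (updateAt)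
open import Data.Vec.Functional.Properties using (updateAt-updates; updateAt-minimal)
open import Function using (_∘_; const)
open import Function.Bundles using (Equivalence)
open import Relation.Binary.PropositionalEquality
open import Relation.Nullary using (¬_; Dec; yes; no; does)
open import Relation.Nullary.Decidable using (dec-true; dec-false)

module _ (G : Game) where
  open Game G

  module _ {m : ℕ} (Init : V G → Fin m) (Upd : Fin m → V G → Fin m) where

    memory : Play G → ℕ → Fin m
    memory π zero    = Init (ρ π 0)
    memory π (suc t) = Upd (memory π t) (ρ π (suc t))

    updFrom-∷ʳ : ∀ s xs x → updFrom G Init Upd s (xs ∷ʳ x) ≡ Upd (updFrom G Init Upd s xs) x
    updFrom-∷ʳ s []       x = refl
    updFrom-∷ʳ s (y ∷ xs) x = updFrom-∷ʳ (Upd s y) xs x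

    upd⁺-∷ʳ : ∀ h x v → upd⁺ G Init Upd (h ∷ʳ x) v ≡ Upd (upd⁺ G Init Upd h x) v
    upd⁺-∷ʳ []      x v = refl
    upd⁺-∷ʳ (y ∷ h) x v = cong (λ s → Upd s v) (updFrom-∷ʳ (Init y) h x)

    prefix-suc : ∀ π t → prefix G π (suc t) ≡ prefix G π t ∷ʳ ρ π t
    prefix-suc π t = trans (cong (map (ρ π)) (sym (upTo-∷ʳ t))) (map-++ (ρ π) (upTo t) _)

    upd⁺-prefix : ∀ π t → upd⁺ G Init Upd (prefix G π t) (ρ π t) ≡ memory π t
    upd⁺-prefix π zero    = refl
    upd⁺-prefix π (suc t) = begin
      upd⁺ G Init Upd (prefix G π (suc t)) (ρ π (suc t))
        ≡⟨ cong (λ h → upd⁺ G Init Upd h (ρ π (suc t))) (prefix-suc π t) ⟩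
      upd⁺ G Init Upd (prefix G π t ∷ʳ ρ π t) (ρ π (suc t))
        ≡⟨ upd⁺-∷ʳ (prefix G π t) (ρ π t) (ρ π (suc t)) ⟩
      Upd (upd⁺ G Init Upd (prefix G π t) (ρ π t)) (ρ π (suc t))
        ≡⟨ cong (λ s → Upd s (ρ π (suc t))) (upd⁺-prefix π t) ⟩
      memory π (suc t) ∎
      where open ≡-Reasoning

  Successor : V G → Set
  Successor u = Σ[ w ∈ V G ] (edge u w ≡ true)

  Positional : Set
  Positional = (u : V G) → Successor u

  NextMove : Player → ℕ → Set
  NextMove i m = (u : V G) → owner u ≡ i → Fin m → Successor u

  module Outcome {m : ℕ} (Init : V G → Fin m) (Upd : Fin m → V G → Fin m)
                 (Nxt : NextMove P1 m) (v : V G) where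

    σ : Strategy G P1
    σ = implemented G P1 Init Upd Nxt

    moveAs : (i : Player) (u : V G) → owner u ≡ i → Positional → Fin m → Successor u
    moveAs P0 u _ τ s = τ u
    moveAs P1 u o τ s = Nxt u o s

    move : Positional → (u : V G) → Fin m → Successor u
    move τ u = moveAs (owner u) u refl τ

    next : Positional → V G × Fin m → V G × Fin m
    next τ (u , s) = proj₁ (move τ u s) , Upd s (proj₁ (move τ u s))

    state : Positional → ℕ → V G × Fin m
    state τ zero    = v , Init v
    state τ (suc t) = next τ (state τ t)

    play : Positional → Play G
    play τ = record
      { ρ      = λ t → proj₁ (state τ t)
      ; isPath = λ t → proj₂ (move τ (proj₁ (state τ t)) (proj₂ (state τ t))) }

    memory-play : ∀ τ t → memory Init Upd (play τ) t ≡ proj₂ (state τ t)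
    memory-play τ zero    = refl
    memory-play τ (suc t) = cong (λ s → Upd s (ρ (play τ) (suc t))) (memory-play τ t)

    moveAs-P0 : ∀ {τ u s} i (e : owner u ≡ i) → owner u ≡ P0 → proj₁ (moveAs i u e τ s) ≡ proj₁ (τ u)
    moveAs-P0 P0 e o = refl
    moveAs-P0 P1 e o with trans (sym e) o
    ... | ()

    moveAs-P1 : ∀ {τ u s} i (e : owner u ≡ i) (o : owner u ≡ P1) →
                proj₁ (moveAs i u e τ s) ≡ proj₁ (Nxt u o s)
    moveAs-P1 P0 e o with trans (sym e) o
    ... | ()
    moveAs-P1 {u = u} {s} P1 e o = cong (λ o → proj₁ (Nxt u o s)) (uip e o)

    play-P0 : ∀ τ t → owner (ρ (play τ) t) ≡ P0 → ρ (play τ) (suc t) ≡ proj₁ (τ (ρ (play τ) t))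
    play-P0 τ t = moveAs-P0 (owner (ρ (play τ) t)) refl

    play-consistent : ∀ τ → Consistent G σ (play τ)
    play-consistent τ t o = begin
      proj₁ (move τ u s)                        ≡⟨ moveAs-P1 (owner u) refl o ⟩
      proj₁ (Nxt u o s)                         ≡⟨ cong (λ s → proj₁ (Nxt u o s)) (sym (memory-play τ t)) ⟩
      proj₁ (Nxt u o (memory Init Upd (play τ) t))
        ≡⟨ cong (λ s → proj₁ (Nxt u o s)) (sym (upd⁺-prefix Init Upd (play τ) t)) ⟩
      proj₁ (σ (prefix G (play τ) t) u o) ∎
      where
        open ≡-Reasoning
        u = ρ (play τ) t
        s = proj₂ (state τ t)

    AgreeAt : Positional → Positional → V G → Set
    AgreeAt τ τ′ u = owner u ≡ P0 → proj₁ (τ u) ≡ proj₁ (τ′ u)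

    moveAs-agree : ∀ {τ τ′ u s} i (e : owner u ≡ i) → (i ≡ P0 → proj₁ (τ u) ≡ proj₁ (τ′ u)) →
                   proj₁ (moveAs i u e τ s) ≡ proj₁ (moveAs i u e τ′ s)
    moveAs-agree P0 e h = h refl
    moveAs-agree P1 e h = refl

    next-agree : ∀ τ τ′ q → AgreeAt τ τ′ (proj₁ q) → next τ q ≡ next τ′ q
    next-agree τ τ′ (u , s) h = cong (λ w → w , Upd s w) (moveAs-agree (owner u) refl h)

    state-agree : ∀ τ τ′ t L → state τ t ≡ state τ′ t →
                  (∀ l → l < L → AgreeAt τ τ′ (ρ (play τ) (t + l))) →
                  state τ (t + L) ≡ state τ′ (t + L)
    state-agree τ τ′ t zero    eq h = subst (λ t′ → state τ t′ ≡ state τ′ t′) (sym (+-identityʳ t)) eq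
    state-agree τ τ′ t (suc L) eq h = subst (λ t′ → state τ t′ ≡ state τ′ t′) (sym (+-suc t L)) (begin
      next τ (state τ (t + L))   ≡⟨ next-agree τ τ′ (state τ (t + L)) (h L (s≤s ≤-refl)) ⟩
      next τ′ (state τ (t + L))
        ≡⟨ cong (next τ′) (state-agree τ τ′ t L eq (λ l l<L → h l (m<n⇒m<1+n l<L))) ⟩
      next τ′ (state τ′ (t + L)) ∎)
      where open ≡-Reasoning

funToFin-cong : ∀ {m n} {f g : Fin m → Fin n} → (∀ i → f i ≡ g i) → funToFin f ≡ funToFin g
funToFin-cong {zero}  h = refl
funToFin-cong {suc m} h = cong₂ combine (h zero) (funToFin-cong (h ∘ suc))

finToFun-injective : ∀ {m n} {s s′ : Fin (n ^ m)} → (∀ i → finToFun {n} {m} s i ≡ finToFun s′ i) → s ≡ s′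
finToFun-injective {m} {n} {s} {s′} h =
  trans (sym (funToFin-finToFin {m} {n} s)) (trans (funToFin-cong h) (funToFin-finToFin {m} {n} s′))

module CopyGame (n : ℕ) where

  d : ℕ
  d = suc n

  data Vertex : Set where
    start mid sink : Vertex
    choose copy    : Fin d → Fin 2 → Vertex
    test           : Fin d → Vertex

  after : {A : Set} → (Fin d → A) → A → Fin d → A
  after f exit i with view i
  ... | ‵fromℕ     = exit
  ... | ‵inject₁ j = f (suc j)

  after-fromℕ : ∀ {A : Set} (f : Fin d → A) exit → after f exit (fromℕ n) ≡ exit
  after-fromℕ f exit rewrite view-fromℕ n = refl

  after-inject₁ : ∀ {A : Set} (f : Fin d → A) exit (j : Fin n) → after f exit (inject₁ j) ≡ f (suc j)
  after-inject₁ f exit j rewrite view-inject₁ j = refl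

  ownerOf : Vertex → Player
  ownerOf mid        = P1
  ownerOf (copy i _) = after (const P1) P0 i
  ownerOf _          = P0

  testTime sinkTime : ℕ
  testTime = 2 + d + d
  sinkTime = suc testTime

  -- Edges lead exactly one position forward, saturating at the sink, so a play from start is at
  -- position t ⊓ sinkTime at time t.
  pos : Vertex → ℕ
  pos start        = 0
  pos (choose i _) = 1 + toℕ i
  pos mid          = 1 + d
  pos (copy i _)   = 2 + d + toℕ i
  pos (test _)     = testTime
  pos sink         = sinkTime

  nextPos : ℕ → ℕ
  nextPos t = suc t ⊓ sinkTime

  Edge : Vertex → Vertex → Bool
  Edge u w = pos w ≡ᵇ nextPos (pos u)

  Edge⇒pos : ∀ {u w} → Edge u w ≡ true → pos w ≡ nextPos (pos u)
  Edge⇒pos {u} {w} e = ≡ᵇ⇒≡ (pos w) (nextPos (pos u)) (Equivalence.from T-≡ e)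

  pos⇒Edge : ∀ {u w} → pos w ≡ nextPos (pos u) → Edge u w ≡ true
  pos⇒Edge {u} {w} e = Equivalence.to T-≡ (≡⇒≡ᵇ (pos w) (nextPos (pos u)) e)

  pos-after : ∀ (f : Fin d → Vertex) exit c → (∀ j → pos (f j) ≡ c + toℕ j) → pos exit ≡ c + d →
              ∀ i → pos (after f exit i) ≡ suc (c + toℕ i)
  pos-after f exit c hf he i with view i
  ... | ‵fromℕ     = trans he (trans (+-suc c n) (cong (λ m → suc (c + m)) (sym (toℕ-fromℕ n))))
  ... | ‵inject₁ j = trans (hf (suc j)) (trans (+-suc c (toℕ j)) (cong (λ m → suc (c + m)) (sym (toℕ-inject₁ j))))

  advance : (x y : Fin d → Fin 2) → Fin d → Vertex → Vertex
  advance x y k start        = choose zero (x zero)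
  advance x y k (choose i _) = after (λ j → choose j (x j)) mid i
  advance x y k mid          = copy zero (y zero)
  advance x y k (copy i _)   = after (λ j → copy j (y j)) (test k) i
  advance x y k (test _)     = sink
  advance x y k sink         = sink

  toℕ≤ : ∀ (i : Fin d) {m} → d ≤ m → toℕ i ≤ m
  toℕ≤ i d≤m = <⇒≤ (<-≤-trans (toℕ<n i) d≤m)

  toℕ≢ : ∀ (i : Fin d) {m} → d ≤ m → toℕ i ≢ m
  toℕ≢ i d≤m = <⇒≢ (<-≤-trans (toℕ<n i) d≤m)

  d≤testTime : d ≤ testTime
  d≤testTime = m≤n⇒m≤o+n 2 (m≤m+n d d)

  choose-pos≤ : ∀ (i : Fin d) → 1 + toℕ i ≤ testTime
  choose-pos≤ i = s≤s (toℕ≤ i (m≤n⇒m≤o+n 1 (m≤m+n d d)))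

  copy-pos≤ : ∀ (j : Fin d) → 2 + d + toℕ j ≤ testTime
  copy-pos≤ j = s≤s (s≤s (+-monoʳ-≤ d (<⇒≤ (toℕ<n j))))

  before-copy≤ : ∀ (j : Fin d) → 1 + d + toℕ j ≤ testTime
  before-copy≤ j = ≤-trans (n≤1+n _) (copy-pos≤ j)

  pos-advance : ∀ x y k u → pos (advance x y k u) ≡ nextPos (pos u)
  pos-advance x y k start        = refl
  pos-advance x y k (choose i _) = trans (pos-after _ mid 1 (λ _ → refl) refl i)
    (sym (m≤n⇒m⊓n≡m (s≤s (choose-pos≤ i))))
  pos-advance x y k mid          = trans (cong (λ m → 2 + m) (+-identityʳ d))
    (sym (m≤n⇒m⊓n≡m (s≤s (s≤s (m≤n⇒m≤o+n 1 (m≤m+n d d))))))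
  pos-advance x y k (copy i _)   = trans (pos-after _ (test k) (2 + d) (λ _ → refl) refl i)
    (sym (m≤n⇒m⊓n≡m (s≤s (copy-pos≤ i))))
  pos-advance x y k (test _)     = sym (⊓-idem sinkTime)
  pos-advance x y k sink         = sym (m≥n⇒m⊓n≡n (n≤1+n sinkTime))

  pos⁻¹-choose : ∀ u i → pos u ≡ 1 + toℕ i → Σ[ b ∈ Fin 2 ] u ≡ choose i b
  pos⁻¹-choose start        i ()
  pos⁻¹-choose (choose j b) i e = b , cong (λ j → choose j b) (toℕ-injective (suc-injective e))
  pos⁻¹-choose mid          i e = ⊥-elim (toℕ≢ i ≤-refl (sym (suc-injective e)))
  pos⁻¹-choose (copy j _)   i e = ⊥-elim (toℕ≢ i (m≤n⇒m≤o+n 1 (m≤m+n d _)) (sym (suc-injective e)))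
  pos⁻¹-choose (test _)     i e = ⊥-elim (toℕ≢ i (m≤n⇒m≤o+n 1 (m≤m+n d d)) (sym (suc-injective e)))
  pos⁻¹-choose sink         i e = ⊥-elim (toℕ≢ i (m≤n⇒m≤o+n 2 (m≤m+n d d)) (sym (suc-injective e)))

  pos⁻¹-mid : ∀ u → pos u ≡ 1 + d → u ≡ mid
  pos⁻¹-mid start        ()
  pos⁻¹-mid (choose j _) e = ⊥-elim (toℕ≢ j ≤-refl (suc-injective e))
  pos⁻¹-mid mid          e = refl
  pos⁻¹-mid (copy j _)   e = ⊥-elim (m≢1+m+n d (sym (suc-injective e)))
  pos⁻¹-mid (test _)     e = ⊥-elim (m≢1+m+n d (sym (suc-injective e)))
  pos⁻¹-mid sink         e = ⊥-elim (m≢1+n+m d {suc d} (sym (suc-injective e)))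

  pos⁻¹-copy : ∀ u i → pos u ≡ 2 + d + toℕ i → Σ[ b ∈ Fin 2 ] u ≡ copy i b
  pos⁻¹-copy start        i ()
  pos⁻¹-copy (choose j _) i e = ⊥-elim (toℕ≢ j (m≤n⇒m≤o+n 1 (m≤m+n d _)) (suc-injective e))
  pos⁻¹-copy mid          i e = ⊥-elim (m≢1+m+n d (suc-injective e))
  pos⁻¹-copy (copy j b)   i e =
    b , cong (λ j → copy j b) (toℕ-injective (+-cancelˡ-≡ d _ _ (suc-injective (suc-injective e))))
  pos⁻¹-copy (test _)     i e = ⊥-elim (toℕ≢ i ≤-refl (sym (+-cancelˡ-≡ d _ _ (suc-injective (suc-injective e)))))
  pos⁻¹-copy sink         i e = ⊥-elim (toℕ≢ i (n≤1+n d)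
    (sym (+-cancelˡ-≡ d _ _ (trans (+-suc d d) (suc-injective (suc-injective e))))))

  pos⁻¹-test : ∀ u → pos u ≡ testTime → Σ[ k ∈ Fin d ] u ≡ test k
  pos⁻¹-test start        ()
  pos⁻¹-test (choose j _) e = ⊥-elim (toℕ≢ j (m≤n⇒m≤o+n 1 (m≤m+n d d)) (suc-injective e))
  pos⁻¹-test mid          e = ⊥-elim (m≢1+m+n d (suc-injective e))
  pos⁻¹-test (copy j _)   e = ⊥-elim (toℕ≢ j ≤-refl (+-cancelˡ-≡ d _ _ (suc-injective (suc-injective e))))
  pos⁻¹-test (test k)     e = k , refl
  pos⁻¹-test sink         e = ⊥-elim (1+n≢n e)

  pos⁻¹-sink : ∀ u → pos u ≡ sinkTime → u ≡ sink
  pos⁻¹-sink start        ()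
  pos⁻¹-sink (choose j _) e = ⊥-elim (toℕ≢ j (m≤n⇒m≤o+n 2 (m≤m+n d d)) (suc-injective e))
  pos⁻¹-sink mid          e = ⊥-elim (m≢1+n+m d {suc d} (suc-injective e))
  pos⁻¹-sink (copy j _)   e = ⊥-elim (toℕ≢ j (n≤1+n d)
    (+-cancelˡ-≡ d _ _ (trans (suc-injective (suc-injective e)) (sym (+-suc d d)))))
  pos⁻¹-sink (test _)     e = ⊥-elim (1+n≢n (sym e))
  pos⁻¹-sink sink         e = refl

  requests : Fin 2 × Fin d → Vertex → Bool
  requests (r , i) (choose j b) = does (j ≟ i) ∧ does (b ≟ r)
  requests _       _            = false

  answers : Fin 2 × Fin d → Vertex → Bool
  answers (r , i) (copy j c) = does (j ≟ i) ∧ not (does (c ≟ r))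
  answers (r , i) (test k)   = not (does (k ≟ i))
  answers _       _          = false

  isSink : Vertex → Bool
  isSink sink = true
  isSink _    = false

  requests-choose : ∀ r i → requests (r , i) (choose i r) ≡ true
  requests-choose r i rewrite dec-true (i ≟ i) refl | dec-true (r ≟ r) refl = refl

  requests-sound : ∀ {r i} u → requests (r , i) u ≡ true → u ≡ choose i r
  requests-sound {r} {i} (choose j b) q with j ≟ i | b ≟ r
  ... | yes refl | yes refl = refl
  requests-sound (choose j b) () | no _  | _
  requests-sound (choose j b) () | yes _ | no _

  answers-copy : ∀ {r i j c} → j ≡ i → c ≢ r → answers (r , i) (copy j c) ≡ true
  answers-copy {r} {i} {c = c} refl c≢r rewrite dec-true (i ≟ i) refl | dec-false (c ≟ r) c≢r = refl

  answers-test : ∀ {r i k} → k ≢ i → answers (r , i) (test k) ≡ true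
  answers-test {r} {i} {k} k≢i rewrite dec-false (k ≟ i) k≢i = refl

  answers-sound : ∀ {r i} u → answers (r , i) u ≡ true →
                  (Σ[ c ∈ Fin 2 ] u ≡ copy i c × c ≢ r) ⊎ (Σ[ k ∈ Fin d ] u ≡ test k × k ≢ i)
  answers-sound {r} {i} (copy j c) a with j ≟ i | c ≟ r
  ... | yes refl | no c≢r = inj₁ (c , refl , c≢r)
  answers-sound (copy j c) () | yes _ | yes _
  answers-sound (copy j c) () | no _  | _
  answers-sound {r} {i} (test k) a with k ≟ i
  ... | no k≢i = inj₂ (k , refl , k≢i)
  answers-sound (test k) () | yes _

  fromCode : Fin 8 × Fin d → Vertex
  fromCode (zero , i)                                          = choose i zero
  fromCode (suc zero , i)                                      = choose i (suc zero)
  fromCode (suc (suc zero) , i)                                = copy i zero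
  fromCode (suc (suc (suc zero)) , i)                          = copy i (suc zero)
  fromCode (suc (suc (suc (suc zero))) , i)                    = test i
  fromCode (suc (suc (suc (suc (suc zero)))) , _)              = start
  fromCode (suc (suc (suc (suc (suc (suc zero))))) , _)        = mid
  fromCode (suc (suc (suc (suc (suc (suc (suc zero)))))) , _)  = sink

  toCode : Vertex → Fin 8 × Fin d
  toCode (choose i zero)       = zero , i
  toCode (choose i (suc zero)) = suc zero , i
  toCode (copy i zero)         = suc (suc zero) , i
  toCode (copy i (suc zero))   = suc (suc (suc zero)) , i
  toCode (test i)              = suc (suc (suc (suc zero))) , i
  toCode start                 = suc (suc (suc (suc (suc zero)))) , zero
  toCode mid                   = suc (suc (suc (suc (suc (suc zero))))) , zero
  toCode sink                  = suc (suc (suc (suc (suc (suc (suc zero)))))) , zero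

  fromCode-toCode : ∀ u → fromCode (toCode u) ≡ u
  fromCode-toCode (choose i zero)       = refl
  fromCode-toCode (choose i (suc zero)) = refl
  fromCode-toCode (copy i zero)         = refl
  fromCode-toCode (copy i (suc zero))   = refl
  fromCode-toCode (test i)              = refl
  fromCode-toCode start                 = refl
  fromCode-toCode mid                   = refl
  fromCode-toCode sink                  = refl

  opaque
    decode : Fin (8 * d) → Vertex
    decode v = fromCode (remQuot d v)

    encode : Vertex → Fin (8 * d)
    encode u = uncurry combine (toCode u)

    decode-encode : ∀ u → decode (encode u) ≡ u
    decode-encode u = trans (cong fromCode (remQuot-combine (proj₁ (toCode u)) (proj₂ (toCode u)))) (fromCode-toCode u)

  following : (x y : Fin d → Fin 2) → Fin d →
              (v : Fin (8 * d)) → Σ[ w ∈ Fin (8 * d) ] (Edge (decode v) (decode w) ≡ true)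
  following x y k v = encode (advance x y k u) ,
    subst (λ w → Edge u w ≡ true) (sym (decode-encode (advance x y k u)))
          (pos⇒Edge {u} {advance x y k u} (pos-advance x y k u))
    where u = decode v

  zeros : Fin d → Fin 2
  zeros _ = zero

  game : Game
  game = record
    { nV    = 8 * d
    ; owner = ownerOf ∘ decode
    ; edge  = λ v w → Edge (decode v) (decode w)
    ; total = following zeros zeros zero
    ; k     = 2 * d
    ; Q     = λ c v → requests (remQuot d c) (decode v)
    ; P     = λ c v → answers (remQuot d c) (decode v)
    ; Cst   = λ c v _ → isSink (decode v)
    }

  module Run (π : Play game) (from-start : ρ π 0 ≡ encode start) where

    at : ℕ → Vertex
    at t = decode (ρ π t)

    start-at : at 0 ≡ start
    start-at = trans (cong decode from-start) (decode-encode start)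

    pos-at : ∀ t → pos (at t) ≡ t ⊓ sinkTime
    pos-at zero    = cong pos start-at
    pos-at (suc t) = begin
      pos (at (suc t))                   ≡⟨ Edge⇒pos {at t} {at (suc t)} (isPath π t) ⟩
      nextPos (pos (at t))               ≡⟨ cong nextPos (pos-at t) ⟩
      suc t ⊓ suc sinkTime ⊓ sinkTime    ≡⟨ ⊓-assoc (suc t) (suc sinkTime) sinkTime ⟩
      suc t ⊓ (suc sinkTime ⊓ sinkTime)  ≡⟨ cong (suc t ⊓_) (m≥n⇒m⊓n≡n (n≤1+n sinkTime)) ⟩
      suc t ⊓ sinkTime                   ∎
      where open ≡-Reasoning

    pos-at-≤ : ∀ t → t ≤ testTime → pos (at t) ≡ t
    pos-at-≤ t t≤ = trans (pos-at t) (m≤n⇒m⊓n≡m (m≤n⇒m≤1+n t≤))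

    sink-after : ∀ t → sinkTime ≤ t → at t ≡ sink
    sink-after t le = pos⁻¹-sink (at t) (trans (pos-at t) (m≥n⇒m⊓n≡n le))

    pos-visited : ∀ {t u} → at t ≡ u → u ≢ sink → pos u ≡ t
    pos-visited {t} {u} eq u≢sink with ⊓-sel t sinkTime
    ... | inj₁ e = trans (cong pos (sym eq)) (trans (pos-at t) e)
    ... | inj₂ e = ⊥-elim (u≢sink (pos⁻¹-sink u (trans (cong pos (sym eq)) (trans (pos-at t) e))))

    before-choose : ∀ x y k i → ownerOf (at (toℕ i)) ≡ P0 × advance x y k (at (toℕ i)) ≡ choose i (x i)
    before-choose x y k zero    = subst (λ u → ownerOf u ≡ P0 × advance x y k u ≡ choose zero (x zero))
      (sym start-at) (refl , refl)
    before-choose x y k (suc j) = subst (λ u → ownerOf u ≡ P0 × advance x y k u ≡ choose (suc j) (x (suc j)))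
      (sym (proj₂ previous)) (refl , after-inject₁ _ mid j)
      where
        previous = pos⁻¹-choose (at (suc (toℕ j))) (inject₁ j)
          (trans (pos-at-≤ _ (toℕ≤ (suc j) d≤testTime)) (cong suc (sym (toℕ-inject₁ j))))

    before-mid : ∀ x y k → ownerOf (at d) ≡ P0 × advance x y k (at d) ≡ mid
    before-mid x y k = subst (λ u → ownerOf u ≡ P0 × advance x y k u ≡ mid)
      (sym (proj₂ previous)) (refl , after-fromℕ _ mid)
      where
        previous = pos⁻¹-choose (at d) (fromℕ n) (trans (pos-at-≤ d d≤testTime) (cong suc (sym (toℕ-fromℕ n))))

    before-copy : ∀ x y k j → ownerOf (at (1 + d + toℕ j)) ≡ P1 × advance x y k (at (1 + d + toℕ j)) ≡ copy j (y j)
    before-copy x y k zero    = subst (λ u → ownerOf u ≡ P1 × advance x y k u ≡ copy zero (y zero))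
      (sym (pos⁻¹-mid (at (1 + d + 0)) (trans (pos-at-≤ _ (before-copy≤ zero)) (cong suc (+-identityʳ d)))))
      (refl , refl)
    before-copy x y k (suc j) = subst (λ u → ownerOf u ≡ P1 × advance x y k u ≡ copy (suc j) (y (suc j)))
      (sym (proj₂ previous)) (after-inject₁ (const P1) P0 j , after-inject₁ _ (test k) j)
      where
        previous = pos⁻¹-copy (at (1 + d + toℕ (suc j))) (inject₁ j) (trans (pos-at-≤ _ (before-copy≤ (suc j)))
          (cong suc (trans (+-suc d (toℕ j)) (cong (λ m → suc (d + m)) (sym (toℕ-inject₁ j))))))

    before-test : ∀ x y k → ownerOf (at (1 + d + d)) ≡ P0 × advance x y k (at (1 + d + d)) ≡ test k
    before-test x y k = subst (λ u → ownerOf u ≡ P0 × advance x y k u ≡ test k)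
      (sym (proj₂ previous)) (after-fromℕ (const P1) P0 , after-fromℕ _ (test k))
      where
        previous = pos⁻¹-copy (at (1 + d + d)) (fromℕ n) (trans (pos-at-≤ _ (n≤1+n _))
          (cong suc (trans (+-suc d n) (cong (λ m → suc (d + m)) (sym (toℕ-fromℕ n))))))

    P1-turn : ∀ l → l < d → ownerOf (at (1 + d + l)) ≡ P1
    P1-turn l l<d = subst (λ l → ownerOf (at (1 + d + l)) ≡ P1) (toℕ-fromℕ< l<d)
      (proj₁ (before-copy zeros zeros zero (fromℕ< l<d)))

  remember : Vertex → (Fin d → Fin 2) → Fin d → Fin 2
  remember (choose i b) f = updateAt f i (const b)
  remember _            f = f

  remember-other : ∀ u f i → (∀ b → u ≢ choose i b) → remember u f i ≡ f i
  remember-other (choose j b) f i h with i ≟ j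
  ... | yes refl = ⊥-elim (h b refl)
  ... | no i≢j   = updateAt-minimal i j f i≢j
  remember-other start        f i h = refl
  remember-other mid          f i h = refl
  remember-other sink         f i h = refl
  remember-other (copy _ _)   f i h = refl
  remember-other (test _)     f i h = refl

  copyInit : Fin (8 * d) → Fin (2 ^ d)
  copyInit _ = funToFin zeros

  copyUpd : Fin (2 ^ d) → Fin (8 * d) → Fin (2 ^ d)
  copyUpd s v = funToFin (remember (decode v) (finToFun s))

  copyNxt : NextMove game P1 (2 ^ d)
  copyNxt u _ s = following zeros (finToFun s) zero u

  choose-bit : ∀ {i j b c} → choose i b ≡ choose j c → b ≡ c
  choose-bit refl = refl

  copy-bit : ∀ {i j b c} → copy i b ≡ copy j c → b ≡ c
  copy-bit refl = refl

  test-index : ∀ {k k′} → test k ≡ test k′ → k ≡ k′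
  test-index refl = refl

  module CopyStrategy (π : Play game) (from-start : ρ π 0 ≡ encode start)
                  (consistent : Consistent game (implemented game P1 copyInit copyUpd copyNxt) π) where
    open Run π from-start

    M : ℕ → Fin (2 ^ d)
    M = memory game copyInit copyUpd π

    P1-step : ∀ t → ownerOf (at t) ≡ P1 → at (suc t) ≡ advance zeros (finToFun (M t)) zero (at t)
    P1-step t o = trans (cong decode (consistent t o)) (trans (decode-encode _)
      (cong (λ s → advance zeros (finToFun s) zero (at t)) (upd⁺-prefix game copyInit copyUpd π t)))

    chosen-at : ∀ i → Σ[ b ∈ Fin 2 ] at (1 + toℕ i) ≡ choose i b
    chosen-at i = pos⁻¹-choose (at (1 + toℕ i)) i (pos-at-≤ _ (choose-pos≤ i))

    chosen : Fin d → Fin 2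
    chosen i = proj₁ (chosen-at i)

    remembered : ∀ t i → 1 + toℕ i ≤ t → finToFun (M t) i ≡ chosen i
    remembered zero    i ()
    remembered (suc t) i le with 1 + toℕ i ≟ℕ suc t
    ... | yes refl = trans (finToFun-funToFin (remember (at (suc t)) (finToFun (M t))) i)
      (trans (cong (λ u → remember u (finToFun (M t)) i) (proj₂ (chosen-at i))) (updateAt-updates i (finToFun (M t))))
    ... | no ne = trans (finToFun-funToFin (remember (at (suc t)) (finToFun (M t))) i)
      (trans (remember-other (at (suc t)) (finToFun (M t)) i (λ b eq → ne (pos-visited eq λ ())))
             (remembered t i (s≤s⁻¹ (≤∧≢⇒< le ne))))

    copied : ∀ j → at (2 + d + toℕ j) ≡ copy j (chosen j)
    copied j = trans (P1-step _ (proj₁ previous))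
      (trans (proj₂ previous) (cong (copy j) (remembered _ j (s≤s (m≤n+m (toℕ j) d)))))
      where previous = before-copy zeros (finToFun (M (1 + d + toℕ j))) zero j

    tested-at : Σ[ k ∈ Fin d ] at testTime ≡ test k
    tested-at = pos⁻¹-test (at testTime) (pos-at-≤ testTime ≤-refl)

    k : Fin d
    k = proj₁ tested-at

    unanswered : ∀ t → answers (chosen k , k) (at t) ≡ false
    unanswered t = ¬-not (λ a → refuted (answers-sound (at t) a))
      where
        refuted : (Σ[ c ∈ Fin 2 ] at t ≡ copy k c × c ≢ chosen k) ⊎
                  (Σ[ k′ ∈ Fin d ] at t ≡ test k′ × k′ ≢ k) → ⊥
        refuted (inj₁ (c , eq , c≢)) =
          c≢ (copy-bit (trans (sym eq) (trans (cong at (sym (pos-visited eq λ ()))) (copied k))))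
        refuted (inj₂ (k′ , eq , k′≢)) =
          k′≢ (test-index (trans (sym eq) (trans (cong at (sym (pos-visited eq λ ()))) (proj₂ tested-at))))

    request : Fin (2 * d)
    request = combine (chosen k) k

    wins : WonBy game P1 π
    wins (_ , answered) = answered (1 + toℕ k) ((request , requested , never) , request , requested , increments)
      where
        requested : requests (remQuot d request) (at (1 + toℕ k)) ≡ true
        requested = trans (cong₂ requests (remQuot-combine (chosen k) k) (proj₂ (chosen-at k)))
                          (requests-choose (chosen k) k)
        never : ∀ l → answers (remQuot d request) (at (1 + toℕ k + l)) ≡ false
        never l = trans (cong (λ p → answers p (at (1 + toℕ k + l))) (remQuot-combine (chosen k) k))
          (unanswered (1 + toℕ k + l))
        increments : InfInc game request π (1 + toℕ k)
        increments N = N + sinkTime , m≤m+n N sinkTime ,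
          cong isSink (sink-after _ (≤-trans (m≤n+m sinkTime N) (m≤n+m _ (1 + toℕ k))))

  copy-wins : WinsWithMemory game P1 (encode start) (2 ^ d)
  copy-wins = copyInit , copyUpd , copyNxt , CopyStrategy.wins

  advance-indep : ∀ x y k k′ u → (∀ i b → u ≢ copy i b) → advance x y k u ≡ advance x y k′ u
  advance-indep x y k k′ start        h = refl
  advance-indep x y k k′ (choose _ _) h = refl
  advance-indep x y k k′ mid          h = refl
  advance-indep x y k k′ (copy i b)   h = ⊥-elim (h i b refl)
  advance-indep x y k k′ (test _)     h = refl
  advance-indep x y k k′ sink         h = refl

  P1≢P0 : P1 ≢ P0
  P1≢P0 ()

  module LowerBound {m : ℕ} (Init : Fin (8 * d) → Fin m) (Upd : Fin m → Fin (8 * d) → Fin m)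
                 (Nxt : NextMove game P1 m)
                 (winning : WinningFrom game P1 (implemented game P1 Init Upd Nxt) (encode start)) where
    open Outcome game Init Upd Nxt (encode start)

    -- The argument zeros only determines moves at vertices of Player 1.
    announce : Fin (2 ^ d) → Fin d → Positional game
    announce s k = following (finToFun s) zeros k

    module _ (s : Fin (2 ^ d)) (k : Fin d) where
      open Run (play (announce s k)) refl public

      P0-step : ∀ t → ownerOf (at t) ≡ P0 → at (suc t) ≡ advance (finToFun s) zeros k (at t)
      P0-step t o = trans (cong decode (play-P0 (announce s k) t o)) (decode-encode _)

      announced : ∀ i → at (1 + toℕ i) ≡ choose i (finToFun s i)
      announced i = trans (P0-step (toℕ i) (proj₁ previous)) (proj₂ previous)
        where previous = before-choose (finToFun s) zeros k i

      tested : at testTime ≡ test k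
      tested = trans (P0-step (1 + d + d) (proj₁ previous)) (proj₂ previous)
        where previous = before-test (finToFun s) zeros k

      reaches-mid : ρ (play (announce s k)) (1 + d) ≡ encode mid
      reaches-mid = trans (play-P0 (announce s k) d (proj₁ previous)) (cong encode (proj₂ previous))
        where previous = before-mid (finToFun s) zeros k

      copied : Σ[ c ∈ Fin 2 ] at (2 + d + toℕ k) ≡ copy k c
      copied = pos⁻¹-copy (at (2 + d + toℕ k)) k (pos-at-≤ _ (copy-pos≤ k))

      no-copy-before-mid : ∀ l → l < 1 + d → ∀ i b → at l ≢ copy i b
      no-copy-before-mid l l<1+d i b eq = <⇒≱ (s≤s (m≤n⇒m≤1+n (m≤m+n d (toℕ i))))
        (subst (_≤ d) (sym (pos-visited eq λ ())) (s≤s⁻¹ l<1+d))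

      request-origin : ∀ {r i t} → requests (r , i) (at t) ≡ true → t ≡ 1 + toℕ i × r ≡ finToFun s i
      request-origin {r} {i} {t} q = sym time ,
        choose-bit (trans (sym eq) (trans (cong at (sym time)) (announced i)))
        where
          eq = requests-sound (at t) q
          time = pos-visited eq (λ ())

      answered-later : ∀ {p t} t′ → t ≤ t′ → answers p (at t′) ≡ true →
                       ¬ (∀ l → answers p (at (t + l)) ≡ false)
      answered-later {p} {t} t′ t≤t′ a never
        with trans (sym a) (trans (cong (λ t″ → answers p (at t″)) (sym (m+[n∸m]≡n t≤t′))) (never (t′ ∸ t)))
      ... | ()

      P0-wins : proj₁ copied ≢ finToFun s k → BndCostStreett game (play (announce s k))
      P0-wins c≢ = (0 , sinkTime , λ t le c′ → inj₁ (cong (requests (remQuot d c′)) (sink-after t le))) ,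
                   λ t ((c′ , q , never) , _) → answered (remQuot d c′) t q never
        where
          answered : ∀ p t → requests p (at t) ≡ true → ¬ (∀ l → answers p (at (t + l)) ≡ false)
          answered (r , i) t q = by-index (i ≟ k)
            where
              origin = request-origin {r} {i} {t} q
              t≤d : t ≤ d
              t≤d = subst (_≤ d) (sym (proj₁ origin)) (toℕ<n i)
              by-index : Dec (i ≡ k) → ¬ (∀ l → answers (r , i) (at (t + l)) ≡ false)
              by-index (yes i≡k) = answered-later (2 + d + toℕ k) (≤-trans t≤d (m≤n⇒m≤o+n 2 (m≤m+n d (toℕ k))))
                (trans (cong (answers (r , i)) (proj₂ copied))
                       (answers-copy (sym i≡k) (λ e → c≢ (trans e (trans (proj₂ origin) (cong (finToFun s) i≡k))))))
              by-index (no i≢k)  = answered-later testTime (≤-trans t≤d d≤testTime)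
                (trans (cong (answers (r , i)) tested) (answers-test {r} (i≢k ∘ sym)))

    memory-at-mid : Fin (2 ^ d) → Fin m
    memory-at-mid s = proj₂ (state (announce s zero) (1 + d))

    same-state-at-mid : ∀ s k → state (announce s k) (1 + d) ≡ state (announce s zero) (1 + d)
    same-state-at-mid s k = state-agree (announce s k) (announce s zero) 0 (1 + d) refl
      (λ l l<1+d _ → cong encode (advance-indep (finToFun s) zeros k zero _ (no-copy-before-mid s k l l<1+d)))

    module _ {s s′ : Fin (2 ^ d)} (same : memory-at-mid s ≡ memory-at-mid s′) (k : Fin d) where

      same-at-mid : state (announce s k) (1 + d) ≡ state (announce s′ k) (1 + d)
      same-at-mid = trans (same-state-at-mid s k)
        (trans (cong₂ _,_ (trans (reaches-mid s zero) (sym (reaches-mid s′ zero))) same) (sym (same-state-at-mid s′ k)))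

      same-at-copy : state (announce s k) (2 + d + toℕ k) ≡ state (announce s′ k) (2 + d + toℕ k)
      same-at-copy = subst (λ t → state (announce s k) t ≡ state (announce s′ k) t) (cong suc (+-suc d (toℕ k)))
        (state-agree (announce s k) (announce s′ k) (1 + d) (suc (toℕ k)) same-at-mid
          (λ l l≤k o → ⊥-elim (P1≢P0 (trans (sym (P1-turn s k l (≤-trans l≤k (toℕ<n k)))) o))))

      no-differing-bit : finToFun s k ≢ finToFun s′ k → ⊥
      no-differing-bit differ = by-copy (proj₁ (copied s k) ≟ finToFun s k)
        where
          same-copy : proj₁ (copied s′ k) ≡ proj₁ (copied s k)
          same-copy = copy-bit (trans (sym (proj₂ (copied s′ k)))
            (trans (cong (decode ∘ proj₁) (sym same-at-copy)) (proj₂ (copied s k))))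
          by-copy : Dec (proj₁ (copied s k) ≡ finToFun s k) → ⊥
          by-copy (no c≢)  = winning (play (announce s k)) refl (play-consistent (announce s k)) (P0-wins s k c≢)
          by-copy (yes c≡) = winning (play (announce s′ k)) refl (play-consistent (announce s′ k))
            (P0-wins s′ k (λ c′≡ → differ (trans (sym c≡) (trans (sym same-copy) c′≡))))

    too-few-states : m < 2 ^ d → ⊥
    too-few-states m<2^d with pigeonhole m<2^d memory-at-mid
    ... | s , s′ , s<s′ , same with ¬∀⟶∃¬ d (λ k → finToFun s k ≡ finToFun s′ k)
                                       (λ k → finToFun s k ≟ finToFun s′ k)
                                       (λ agree → <ᶠ⇒≢ s<s′ (finToFun-injective agree))
    ... | k , differ = no-differing-bit same k differ

lemma6p4 : Σ[ a ∈ ℕ ] Σ[ b ∈ ℕ ] ((d : ℕ) → 1 ≤ d →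
    Σ[ G ∈ Game ] Σ[ v ∈ Fin (Game.nV G) ]
    ((Game.nV G ≤ a * d + b)
    × (Game.k G ≡ 2 * d)
    × WinsWithMemory G P1 v (2 ^ d)
    × ((m : ℕ) → m < 2 ^ d → ¬ WinsWithMemory G P1 v m)))
lemma6p4 = 8 , 0 , λ where
  (suc n) _ → let open CopyGame n in
    game , encode start , m≤m+n (8 * d) 0 , refl , copy-wins ,
    λ m m<2^d (Init , Upd , Nxt , winning) → LowerBound.too-few-states Init Upd Nxt winning m<2^d
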